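{- Let $n>m>0$ and let $x=(x_1,\ldots,x_{n+m-1})$. (a) If $ED_{n-m+1}(x_m,\ldots,x_n)=0$ then $ED_n^{\boxplus m}(x_1,\ldots,x_{n+m-1})=0^m$. (b) If $ED_{n-m+1}(x_m,\ldots,x_n)=1$, define $i_L=\max\{j\in[m-1]\mid ED_{n-j+1}(x_j,\ldots,x_n)=0\}$ (with $i_L=0$ if the set is empty) and $i_R=\min\{j\in[m-1]\mid ED_{n-m+j}(x_m,\ldots,x_{n+j})=0\}$ (with $i_R=m$ if the set is empty). Then $$ED_n^{\boxplus m}(x_1,\ldots,x_{n+m-1})=0^{i_L}1^{m-i_L}\ \land\ 1^{i_R}0^{m-i_R}\ \land\ ED_{m-1}^{\boxplus m}(x_1,\ldots,x_{m-1},x_{n+1},\ldots,x_{n+m-1}),$$ where $\land$ denotes bitwise conjunction of length-$m$ bit strings.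
   Context: $ED_\ell(y_1,\ldots,y_\ell)=1$ if the $y_i$ are pairwise distinct and $0$ otherwise. For a function $f$ on strings of length $\ell$, $f^{\boxplus t}$ maps a string $z$ of length $\ell+t-1$ to $(f(z_i,\ldots,z_{i+\ell-1}))_{i=1}^{t}$, written as a string of $t$ outputs. -}

module Defs where

open import Data.Nat using (ℕ; zero; suc; _∸_; _+_)
open import Data.Bool using (Bool; true; false; if_then_else_; _∧_)
open import Data.List using (List; take; drop; map; upTo; zipWith; replicate; _++_)
open import Data.Maybe using (Maybe; just; nothing)
open import Relation.Binary.Definitions using (DecidableEquality)
open import Relation.Nullary.Decidable using (isYes)
open import Data.List.Relation.Unary.Unique.Propositional.Properties using ()
import Data.List.Relation.Unary.Unique.DecPropositional as UDec

-- ED(y) = true iff the entries of y are pairwise distinct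
-- (the subscript ℓ of ED_ℓ is the length of the argument list).
ED : {A : Set} → DecidableEquality A → List A → Bool
ED _≟_ ys = isYes (UDec.unique? _≟_ ys)

-- f^{⊞t}: z of length ℓ+t-1 ↦ (f(z_i..z_{i+ℓ-1}))_{i=1..t}
boxplus : {A : Set} → ℕ → (List A → Bool) → ℕ → List A → List Bool
boxplus ℓ f t z = map (λ i → f (take ℓ (drop i z))) (upTo t)

-- 1-based contiguous substring x_a, …, x_b
slice : {A : Set} → ℕ → ℕ → List A → List A
slice a b x = take (suc b ∸ a) (drop (a ∸ 1) x)

_∧ᵇ_ : List Bool → List Bool → List Bool
_∧ᵇ_ = zipWith _∧_

maxFalse : ℕ → (ℕ → Bool) → ℕ
maxFalse zero p = 0
maxFalse (suc k) p = if p (suc k) then maxFalse k p else suc k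

minFalse : ℕ → (ℕ → Bool) → Maybe ℕ
minFalse zero p = nothing
minFalse (suc k) p with minFalse k p
... | just j = just j
... | nothing = if p (suc k) then nothing else just (suc k)

module Submission where

-- Write m = a + 1 and cut x = L ++ M ++ R with |L| = |R| = a, so that
-- M = x_m … x_n is the block shared by all m windows.  The window starting
-- at (0-based) position i ≤ a is  drop i L ++ M ++ take i R.  A list
-- P ++ M ++ S has distinct entries iff P ++ M, M ++ S and P ++ S have, so
--   ED(window i) = ED(drop i L ++ M) ∧ ED(M ++ take i R) ∧ ED(drop i L ++ take i R).
-- If M is not distinct every window fails (part (a)).  Otherwise the first
-- factor is upward closed in i, hence a bit string 0^{i_L} 1^{m-i_L}; the
-- second is downward closed, hence 1^{i_R} 0^{m-i_R}; the third is the
-- i-th window of length a of L ++ R (part (b)).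

open import Defs
open import Data.Nat using (ℕ; zero; suc; pred; _+_; _∸_; _<_; _≤_; z≤n; s≤s)
open import Data.Nat.Properties
open import Data.Bool using (Bool; true; false; _∧_)
open import Data.List using (List; []; _∷_; length; replicate; take; drop; _++_; applyUpTo)
open import Data.List.Properties using (map-applyUpTo; take-take; length-take; length-drop; take++drop≡id; drop-drop; drop-all; ++-assoc; ++-identityʳ)
open import Data.List.Relation.Unary.All.Properties as All using ()
open import Data.List.Relation.Unary.AllPairs using ([]; _∷_)
open import Data.List.Relation.Unary.Unique.Propositional using (Unique)
open import Data.List.Relation.Unary.Unique.Propositional.Properties using (take⁺)
import Data.List.Relation.Unary.Unique.DecPropositional as UniqueDec
open import Data.Maybe using (just; nothing; fromMaybe)
open import Data.Product using (Σ; _×_; _,_; proj₁; proj₂)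
open import Data.Sum using (inj₁; inj₂)
open import Data.Empty using (⊥-elim)
open import Function using (_∘_)
open import Relation.Nullary using (¬_; yes; no)
open import Relation.Binary.Definitions using (DecidableEquality)
open import Relation.Binary.PropositionalEquality using (_≡_; refl; sym; trans; cong; cong₂; subst; module ≡-Reasoning)

module _ {B : Set} where

  applyUpTo-cong : ∀ (f g : ℕ → B) m → (∀ i → i < m → f i ≡ g i) →
                   applyUpTo f m ≡ applyUpTo g m
  applyUpTo-cong f g zero    _  = refl
  applyUpTo-cong f g (suc m) eq =
    cong₂ _∷_ (eq 0 (s≤s z≤n)) (applyUpTo-cong (f ∘ suc) (g ∘ suc) m (λ i i<m → eq (suc i) (s≤s i<m)))

  applyUpTo-const : ∀ (b : B) m → applyUpTo (λ _ → b) m ≡ replicate m b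
  applyUpTo-const b zero    = refl
  applyUpTo-const b (suc m) = cong (b ∷_) (applyUpTo-const b m)

  blocks : (b b′ : B) (f : ℕ → B) → ∀ m c → c ≤ m →
           (∀ i → i < c → f i ≡ b) → (∀ i → c ≤ i → i < m → f i ≡ b′) →
           replicate c b ++ replicate (m ∸ c) b′ ≡ applyUpTo f m
  blocks b b′ f zero    zero    _       _     _     = refl
  blocks b b′ f (suc m) zero    _       _     above =
    cong₂ _∷_ (sym (above 0 z≤n (s≤s z≤n)))
      (blocks b b′ (f ∘ suc) m zero z≤n (λ _ ()) (λ i _ i<m → above (suc i) z≤n (s≤s i<m)))
  blocks b b′ f (suc m) (suc c) (s≤s c≤m) below above =
    cong₂ _∷_ (sym (below 0 (s≤s z≤n)))
      (blocks b b′ (f ∘ suc) m c c≤m (λ i i<c → below (suc i) (s≤s i<c))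
                                     (λ i c≤i i<m → above (suc i) (s≤s c≤i) (s≤s i<m)))

zipWith-applyUpTo : (f g : ℕ → Bool) → ∀ m →
                    applyUpTo f m ∧ᵇ applyUpTo g m ≡ applyUpTo (λ i → f i ∧ g i) m
zipWith-applyUpTo f g zero    = refl
zipWith-applyUpTo f g (suc m) = cong (f 0 ∧ g 0 ∷_) (zipWith-applyUpTo (f ∘ suc) (g ∘ suc) m)

maxFalse-cong : ∀ k {p q : ℕ → Bool} → (∀ j → 1 ≤ j → j ≤ k → p j ≡ q j) →
                maxFalse k p ≡ maxFalse k q
maxFalse-cong zero    eq = refl
maxFalse-cong (suc k) eq rewrite eq (suc k) (s≤s z≤n) ≤-refl
                               | maxFalse-cong k (λ j 1≤j j≤k → eq j 1≤j (m≤n⇒m≤1+n j≤k)) = refl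

maxFalse-≤ : ∀ k p i → (∀ j → i < j → j ≤ k → p j ≡ true) → maxFalse k p ≤ i
maxFalse-≤ zero    p i holds = z≤n
maxFalse-≤ (suc k) p i holds with p (suc k) in eq
... | true  = maxFalse-≤ k p i (λ j i<j j≤k → holds j i<j (m≤n⇒m≤1+n j≤k))
... | false with suc k ≤? i
...   | yes k<i = k<i
...   | no  k≮i with () ← trans (sym (holds (suc k) (≰⇒> k≮i) ≤-refl)) eq

≤-maxFalse : ∀ k p j → p j ≡ false → 1 ≤ j → j ≤ k → j ≤ maxFalse k p
≤-maxFalse zero    p (suc j) fails _ ()
≤-maxFalse (suc k) p j fails 1≤j j≤k with p (suc k) in eq | m≤n⇒m<n∨m≡n j≤k
... | false | _               = j≤k
... | true  | inj₁ (s≤s j≤k′) = ≤-maxFalse k p j fails 1≤j j≤k′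
... | true  | inj₂ refl with () ← trans (sym eq) fails

minFalse-cong : ∀ k {p q : ℕ → Bool} → (∀ j → 1 ≤ j → j ≤ k → p j ≡ q j) →
                minFalse k p ≡ minFalse k q
minFalse-cong zero    eq = refl
minFalse-cong (suc k) {p} {q} eq
  with minFalse k p | minFalse k q | minFalse-cong k (λ j 1≤j j≤k → eq j 1≤j (m≤n⇒m≤1+n j≤k))
... | just j  | _ | refl = refl
... | nothing | _ | refl rewrite eq (suc k) (s≤s z≤n) ≤-refl = refl

minFalse-≤ : ∀ k p {j} → minFalse k p ≡ just j → j ≤ k
minFalse-≤ (suc k) p found with minFalse k p in eq
minFalse-≤ (suc k) p refl | just j  = m≤n⇒m≤1+n (minFalse-≤ k p eq)
minFalse-≤ (suc k) p found | nothing with p (suc k)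
minFalse-≤ (suc k) p refl | nothing | false = ≤-refl

minFalse-witness : ∀ k p i → p i ≡ false → 1 ≤ i → i ≤ k →
                   Σ ℕ λ j → minFalse k p ≡ just j × j ≤ i
minFalse-witness zero    p (suc i) fails _ ()
minFalse-witness (suc k) p i fails 1≤i i≤k with m≤n⇒m<n∨m≡n i≤k
... | inj₁ (s≤s i≤k′) with minFalse k p | minFalse-witness k p i fails 1≤i i≤k′
...   | just j  | _ , refl , j≤i = j , refl , j≤i
minFalse-witness (suc k) p i fails 1≤i i≤k | inj₂ refl with minFalse k p in eq
... | just j  = j , refl , m≤n⇒m≤1+n (minFalse-≤ k p eq)
... | nothing rewrite fails = suc k , refl , ≤-refl

<-minFalse : ∀ k p i {j} → (∀ l → 1 ≤ l → l ≤ i → p l ≡ true) → minFalse k p ≡ just j → i < j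
<-minFalse (suc k) p i holds found with minFalse k p in eq
<-minFalse (suc k) p i holds refl | just j = <-minFalse k p i holds eq
<-minFalse (suc k) p i holds found | nothing with p (suc k) in eq′
<-minFalse (suc k) p i holds refl | nothing | false with i ≤? k
... | yes i≤k = s≤s i≤k
... | no  i≰k with () ← trans (sym (holds (suc k) (s≤s z≤n) (≰⇒> i≰k))) eq′

UpClosed : ℕ → (ℕ → Bool) → Set
UpClosed k q = ∀ {i j} → i ≤ j → j ≤ k → q i ≡ true → q j ≡ true

DownClosed : ℕ → (ℕ → Bool) → Set
DownClosed k q = ∀ {i j} → i ≤ j → j ≤ k → q j ≡ true → q i ≡ true

upClosed-blocks : ∀ k q → UpClosed k q → q k ≡ true →
  replicate (maxFalse k (q ∘ pred)) false ++ replicate (suc k ∸ maxFalse k (q ∘ pred)) true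
    ≡ applyUpTo q (suc k)
upClosed-blocks k q up top = blocks false true q (suc k) t t≤ below above
  where
  t = maxFalse k (q ∘ pred)
  t≤ : t ≤ suc k
  t≤ = m≤n⇒m≤1+n (maxFalse-≤ k (q ∘ pred) k (λ j k<j j≤k → ⊥-elim (<⇒≱ k<j j≤k)))
  below : ∀ i → i < t → q i ≡ false
  below i i<t with q i in eq
  ... | false = refl
  ... | true  = ⊥-elim (<⇒≱ i<t (maxFalse-≤ k (q ∘ pred) i
                  (λ { (suc j) (s≤s i≤j) j<k → up i≤j (≤-trans (n≤1+n j) j<k) eq })))
  above : ∀ i → t ≤ i → i < suc k → q i ≡ true
  above i t≤i (s≤s i≤k) with q i in eq | m≤n⇒m<n∨m≡n i≤k
  ... | true  | _        = refl
  ... | false | inj₂ refl = trans (sym eq) top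
  ... | false | inj₁ i<k  = ⊥-elim (<⇒≱ (≤-maxFalse k (q ∘ pred) (suc i) eq (s≤s z≤n) i<k) t≤i)

downClosed-blocks : ∀ k q → DownClosed k q → q 0 ≡ true →
  replicate (fromMaybe (suc k) (minFalse k q)) true ++ replicate (suc k ∸ fromMaybe (suc k) (minFalse k q)) false
    ≡ applyUpTo q (suc k)
downClosed-blocks k q down bottom = blocks true false q (suc k) t t≤ below above
  where
  t = fromMaybe (suc k) (minFalse k q)
  t≤ : t ≤ suc k
  t≤ with minFalse k q in eq
  ... | nothing = ≤-refl
  ... | just j  = m≤n⇒m≤1+n (minFalse-≤ k q eq)
  below : ∀ i → i < t → q i ≡ true
  below zero    _   = bottom
  below (suc i) i<t with q (suc i) in eq
  ... | true  = refl
  ... | false with minFalse-witness k q (suc i) eq (s≤s z≤n) (≤-pred (≤-trans i<t t≤))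
  ...   | j , found , j≤i = ⊥-elim (<⇒≱ i<t (subst (_≤ suc i) (sym (cong (fromMaybe (suc k)) found)) j≤i))
  above : ∀ i → t ≤ i → i < suc k → q i ≡ false
  above i t≤i (s≤s i≤k) with q i in eq
  ... | false = refl
  ... | true with minFalse k q in found
  ...   | nothing = ⊥-elim (<⇒≱ (s≤s i≤k) t≤i)
  ...   | just j  = ⊥-elim (<⇒≱ (<-minFalse k q i (λ l _ l≤i → down l≤i i≤k eq) found) t≤i)

module _ {A : Set} where

  take-length-++ : ∀ (xs ys : List A) k → take (length xs + k) (xs ++ ys) ≡ xs ++ take k ys
  take-length-++ []       ys k = refl
  take-length-++ (x ∷ xs) ys k = cong (x ∷_) (take-length-++ xs ys k)

  take-length : ∀ (xs ys : List A) → take (length xs) (xs ++ ys) ≡ xs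
  take-length []       ys = refl
  take-length (x ∷ xs) ys = cong (x ∷_) (take-length xs ys)

  drop-length : ∀ (xs ys : List A) → drop (length xs) (xs ++ ys) ≡ ys
  drop-length []       ys = refl
  drop-length (x ∷ xs) ys = drop-length xs ys

  drop-++ : ∀ k (xs ys : List A) → k ≤ length xs → drop k (xs ++ ys) ≡ drop k xs ++ ys
  drop-++ zero    xs       ys _         = refl
  drop-++ (suc k) (x ∷ xs) ys (s≤s k≤n) = drop-++ k xs ys k≤n

  window : ∀ i (L M R : List A) → i ≤ length L →
           take (length L + length M) (drop i (L ++ M ++ R)) ≡ drop i L ++ M ++ take i R
  window i L M R i≤a = begin
    take n (drop i (L ++ M ++ R))                         ≡⟨ cong (take n) (drop-++ i L (M ++ R) i≤a) ⟩
    take n (drop i L ++ M ++ R)                           ≡⟨ cong (λ t → take t (drop i L ++ M ++ R)) split ⟩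
    take (length (drop i L) + (length M + i)) (drop i L ++ M ++ R) ≡⟨ take-length-++ (drop i L) (M ++ R) (length M + i) ⟩
    drop i L ++ take (length M + i) (M ++ R)              ≡⟨ cong (drop i L ++_) (take-length-++ M R i) ⟩
    drop i L ++ M ++ take i R                             ∎
    where
    open ≡-Reasoning
    a = length L
    n = length L + length M
    split : n ≡ length (drop i L) + (length M + i)
    split = begin
      a + length M                   ≡⟨ cong (_+ length M) (sym (m∸n+n≡m i≤a)) ⟩
      (a ∸ i) + i + length M         ≡⟨ +-assoc (a ∸ i) i (length M) ⟩
      (a ∸ i) + (i + length M)       ≡⟨ cong₂ _+_ (sym (length-drop i L)) (+-comm i (length M)) ⟩
      length (drop i L) + (length M + i) ∎

module _ {A : Set} where

  unique-++⁻ˡ : ∀ (xs : List A) {ys} → Unique (xs ++ ys) → Unique xs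
  unique-++⁻ˡ []       _       = []
  unique-++⁻ˡ (x ∷ xs) (x∉ ∷ u) = All.++⁻ˡ xs x∉ ∷ unique-++⁻ˡ xs u

  unique-++⁻ʳ : ∀ (xs : List A) {ys} → Unique (xs ++ ys) → Unique ys
  unique-++⁻ʳ []       u       = u
  unique-++⁻ʳ (x ∷ xs) (_ ∷ u) = unique-++⁻ʳ xs u

  unique-omit-middle : ∀ (P : List A) {M S} → Unique (P ++ M ++ S) → Unique (P ++ S)
  unique-omit-middle []      {M} u        = unique-++⁻ʳ M u
  unique-omit-middle (p ∷ P) {M} (p∉ ∷ u) =
    All.++⁺ (All.++⁻ˡ P p∉) (All.++⁻ʳ M (All.++⁻ʳ P p∉)) ∷ unique-omit-middle P u

  unique-three⁺ : ∀ (P : List A) {M S} → Unique (P ++ M) → Unique (M ++ S) → Unique (P ++ S) →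
                  Unique (P ++ M ++ S)
  unique-three⁺ []      _        uMS _        = uMS
  unique-three⁺ (p ∷ P) (p∉ ∷ uPM) uMS (p∉′ ∷ uPS) =
    All.++⁺ (All.++⁻ˡ P p∉) (All.++⁺ (All.++⁻ʳ P p∉) (All.++⁻ʳ P p∉′)) ∷ unique-three⁺ P uPM uMS uPS

  unique-three⁻ : ∀ (P : List A) {M S} → Unique (P ++ M ++ S) →
                  Unique (P ++ M) × Unique (M ++ S) × Unique (P ++ S)
  unique-three⁻ P {M} {S} u =
    unique-++⁻ˡ (P ++ M) (subst Unique (sym (++-assoc P M S)) u) , unique-++⁻ʳ P u , unique-omit-middle P u

  unique-drop-++ : ∀ k (xs : List A) {ys} → Unique (xs ++ ys) → Unique (drop k xs ++ ys)
  unique-drop-++ zero    xs       u       = u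
  unique-drop-++ (suc k) []       u       = u
  unique-drop-++ (suc k) (x ∷ xs) (_ ∷ u) = unique-drop-++ k xs u

  unique-++-take : ∀ k (xs : List A) {ys} → Unique (xs ++ ys) → Unique (xs ++ take k ys)
  unique-++-take k xs {ys} u = subst Unique (take-length-++ xs ys k) (take⁺ (length xs + k) u)

  unique-drop-mono : ∀ {i j} (L M : List A) → i ≤ j → Unique (drop i L ++ M) → Unique (drop j L ++ M)
  unique-drop-mono {i} {j} L M i≤j u = subst (λ z → Unique (z ++ M)) shift (unique-drop-++ (j ∸ i) (drop i L) u)
    where
    shift : drop (j ∸ i) (drop i L) ≡ drop j L
    shift = trans (drop-drop i (j ∸ i) L) (cong (λ t → drop t L) (m+[n∸m]≡n i≤j))

  unique-take-anti : ∀ {i j} (M R : List A) → i ≤ j → Unique (M ++ take j R) → Unique (M ++ take i R)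
  unique-take-anti {i} {j} M R i≤j u = subst (λ z → Unique (M ++ z)) shrink (unique-++-take i M u)
    where
    shrink : take i (take j R) ≡ take i R
    shrink = trans (take-take i j R) (cong (λ t → take t R) (m≤n⇒m⊓n≡m i≤j))

module Distinctness {A : Set} (_≟_ : DecidableEquality A) where

  ED-true : ∀ {ys} → Unique ys → ED _≟_ ys ≡ true
  ED-true {ys} u with UniqueDec.unique? _≟_ ys
  ... | yes _ = refl
  ... | no ¬u = ⊥-elim (¬u u)

  ED-false : ∀ {ys} → ¬ Unique ys → ED _≟_ ys ≡ false
  ED-false {ys} ¬u with UniqueDec.unique? _≟_ ys
  ... | yes u = ⊥-elim (¬u u)
  ... | no _  = refl

  ED-sound : ∀ {ys} → ED _≟_ ys ≡ true → Unique ys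
  ED-sound {ys} e with UniqueDec.unique? _≟_ ys
  ED-sound refl | yes u = u

  ED-mono : ∀ {xs ys} → (Unique xs → Unique ys) → ED _≟_ xs ≡ true → ED _≟_ ys ≡ true
  ED-mono f = ED-true ∘ f ∘ ED-sound

  ED-three : ∀ (P Q S : List A) → ED _≟_ (P ++ Q ++ S) ≡ (ED _≟_ (P ++ Q) ∧ ED _≟_ (Q ++ S)) ∧ ED _≟_ (P ++ S)
  ED-three P Q S with UniqueDec.unique? _≟_ (P ++ Q) | UniqueDec.unique? _≟_ (Q ++ S) | UniqueDec.unique? _≟_ (P ++ S)
  ... | yes uPQ | yes uQS | yes uPS = ED-true (unique-three⁺ P uPQ uQS uPS)
  ... | no ¬uPQ | _       | _       = ED-false (¬uPQ ∘ proj₁ ∘ unique-three⁻ P {Q} {S})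
  ... | yes _   | no ¬uQS | _       = ED-false (¬uQS ∘ proj₁ ∘ proj₂ ∘ unique-three⁻ P {Q} {S})
  ... | yes _   | yes _   | no ¬uPS = ED-false (¬uPS ∘ proj₂ ∘ proj₂ ∘ unique-three⁻ P {Q} {S})

module Windows {A : Set} (_≟_ : DecidableEquality A) (L M R : List A) where

  open Distinctness _≟_

  a n : ℕ
  a = length L
  n = length L + length M

  x : List A
  x = L ++ M ++ R

  left right outer : ℕ → Bool
  left  i = ED _≟_ (drop i L ++ M)
  right i = ED _≟_ (M ++ take i R)
  outer i = ED _≟_ (drop i L ++ take i R)

  slice-left : ∀ j → j ≤ a → slice (suc j) n x ≡ drop j L ++ M
  slice-left j j≤a = begin
    take (n ∸ j) (drop j x)                   ≡⟨ cong (take (n ∸ j)) (drop-++ j L (M ++ R) j≤a) ⟩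
    take (n ∸ j) (drop j L ++ M ++ R)         ≡⟨ cong (λ t → take t (drop j L ++ M ++ R)) len ⟩
    take (length (drop j L) + length M) (drop j L ++ M ++ R) ≡⟨ take-length-++ (drop j L) (M ++ R) (length M) ⟩
    drop j L ++ take (length M) (M ++ R)      ≡⟨ cong (drop j L ++_) (take-length M R) ⟩
    drop j L ++ M                             ∎
    where
    open ≡-Reasoning
    len : n ∸ j ≡ length (drop j L) + length M
    len = trans (+-∸-comm (length M) j≤a) (cong (_+ length M) (sym (length-drop j L)))

  slice-right : ∀ j → slice (suc a) (n + j) x ≡ M ++ take j R
  slice-right j = begin
    take (n + j ∸ a) (drop a x)          ≡⟨ cong₂ take len (drop-length L (M ++ R)) ⟩
    take (length M + j) (M ++ R)         ≡⟨ take-length-++ M R j ⟩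
    M ++ take j R                        ∎
    where
    open ≡-Reasoning
    len : n + j ∸ a ≡ length M + j
    len = trans (cong (_∸ a) (+-assoc a (length M) j)) (m+n∸m≡n a (length M + j))

  slice-core : slice (suc a) n x ≡ M
  slice-core = trans (slice-left a ≤-refl) (cong (_++ M) (drop-all a L ≤-refl))

  outer-string : take a x ++ drop n x ≡ L ++ R
  outer-string = cong₂ _++_ (take-length L (M ++ R)) (begin
    drop (a + length M) x                 ≡⟨ sym (drop-drop a (length M) x) ⟩
    drop (length M) (drop a x)            ≡⟨ cong (drop (length M)) (drop-length L (M ++ R)) ⟩
    drop (length M) (M ++ R)              ≡⟨ drop-length M R ⟩
    R                                     ∎)
    where open ≡-Reasoning

  windows : boxplus n (ED _≟_) (suc a) x ≡ applyUpTo (λ i → ED _≟_ (drop i L ++ M ++ take i R)) (suc a)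
  windows = trans (map-applyUpTo (λ i → i) (λ i → ED _≟_ (take n (drop i x))) (suc a))
                  (applyUpTo-cong _ _ (suc a) (λ i i<m → cong (ED _≟_) (window i L M R (≤-pred i<m))))

  outer-windows : boxplus a (ED _≟_) (suc a) (take a x ++ drop n x) ≡ applyUpTo outer (suc a)
  outer-windows = begin
    boxplus a (ED _≟_) (suc a) (take a x ++ drop n x)   ≡⟨ cong (boxplus a (ED _≟_) (suc a)) outer-string ⟩
    boxplus a (ED _≟_) (suc a) (L ++ R)                 ≡⟨ map-applyUpTo (λ i → i) (λ i → ED _≟_ (take a (drop i (L ++ R)))) (suc a) ⟩
    applyUpTo (λ i → ED _≟_ (take a (drop i (L ++ R)))) (suc a) ≡⟨ applyUpTo-cong _ _ (suc a) outer-window ⟩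
    applyUpTo outer (suc a)                             ∎
    where
    open ≡-Reasoning
    -- the windows of L ++ R are those of L ++ [] ++ R
    outer-window : ∀ i → i < suc a → ED _≟_ (take a (drop i (L ++ R))) ≡ outer i
    outer-window i (s≤s i≤a) =
      cong (ED _≟_) (subst (λ t → take t (drop i (L ++ R)) ≡ drop i L ++ take i R)
                           (+-identityʳ a) (window i L [] R i≤a))

  iL iR : ℕ
  iL = maxFalse a (λ j → ED _≟_ (slice j n x))
  iR = fromMaybe (suc a) (minFalse a (λ j → ED _≟_ (slice (suc a) (n + j) x)))

  -- Shortening drop i L as i grows makes the left factor upward closed.
  left-blocks : Unique M → replicate iL false ++ replicate (suc a ∸ iL) true ≡ applyUpTo left (suc a)
  left-blocks uM = subst (λ t → replicate t false ++ replicate (suc a ∸ t) true ≡ applyUpTo left (suc a))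
                         (sym same-threshold) (upClosed-blocks a left up top)
    where
    up : UpClosed a left
    up i≤j _ = ED-mono (unique-drop-mono L M i≤j)
    top : left a ≡ true
    top = ED-true (subst Unique (sym (cong (_++ M) (drop-all a L ≤-refl))) uM)
    same-threshold : iL ≡ maxFalse a (left ∘ pred)
    same-threshold = maxFalse-cong a λ { (suc j) _ j<a → cong (ED _≟_) (slice-left j (≤-trans (n≤1+n j) j<a)) }

  -- Lengthening take i R as i grows makes the right factor downward closed.
  right-blocks : Unique M → replicate iR true ++ replicate (suc a ∸ iR) false ≡ applyUpTo right (suc a)
  right-blocks uM = subst (λ t → replicate t true ++ replicate (suc a ∸ t) false ≡ applyUpTo right (suc a))
                          (sym same-threshold) (downClosed-blocks a right down bottom)
    where
    down : DownClosed a right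
    down i≤j _ = ED-mono (unique-take-anti M R i≤j)
    bottom : right 0 ≡ true
    bottom = ED-true (subst Unique (sym (++-identityʳ M)) uM)
    same-threshold : iR ≡ fromMaybe (suc a) (minFalse a right)
    same-threshold = cong (fromMaybe (suc a)) (minFalse-cong a (λ j _ _ → cong (ED _≟_) (slice-right j)))

  -- Part (a): a repeated entry in the shared block kills every window.
  partA : ED _≟_ (slice (suc a) n x) ≡ false → boxplus n (ED _≟_) (suc a) x ≡ replicate (suc a) false
  partA coreRepeats = trans windows (trans (applyUpTo-cong _ _ (suc a) (λ i _ → ED-false (¬uM ∘ middle i)))
                                           (applyUpTo-const false (suc a)))
    where
    ¬uM : ¬ Unique M
    ¬uM uM with () ← trans (sym (ED-true (subst Unique (sym slice-core) uM))) coreRepeats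
    middle : ∀ i → Unique (drop i L ++ M ++ take i R) → Unique M
    middle i u = unique-++⁻ˡ M (unique-++⁻ʳ (drop i L) u)

  -- Part (b): with a distinct shared block, each window is the conjunction of its three factors.
  partB : ED _≟_ (slice (suc a) n x) ≡ true →
          boxplus n (ED _≟_) (suc a) x
            ≡ ((replicate iL false ++ replicate (suc a ∸ iL) true)
               ∧ᵇ (replicate iR true ++ replicate (suc a ∸ iR) false))
              ∧ᵇ boxplus a (ED _≟_) (suc a) (take a x ++ drop n x)
  partB coreDistinct = begin
    boxplus n (ED _≟_) (suc a) x                                        ≡⟨ windows ⟩
    applyUpTo (λ i → ED _≟_ (drop i L ++ M ++ take i R)) (suc a)        ≡⟨ applyUpTo-cong _ _ (suc a) (λ i _ → ED-three (drop i L) M (take i R)) ⟩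
    applyUpTo (λ i → (left i ∧ right i) ∧ outer i) (suc a)              ≡⟨ sym (zipWith-applyUpTo (λ i → left i ∧ right i) outer (suc a)) ⟩
    applyUpTo (λ i → left i ∧ right i) (suc a) ∧ᵇ applyUpTo outer (suc a) ≡⟨ cong (_∧ᵇ applyUpTo outer (suc a)) (sym (zipWith-applyUpTo left right (suc a))) ⟩
    (applyUpTo left (suc a) ∧ᵇ applyUpTo right (suc a)) ∧ᵇ applyUpTo outer (suc a)
      ≡⟨ cong₂ _∧ᵇ_ (cong₂ _∧ᵇ_ (sym (left-blocks uM)) (sym (right-blocks uM))) (sym outer-windows) ⟩
    ((replicate iL false ++ replicate (suc a ∸ iL) true)
       ∧ᵇ (replicate iR true ++ replicate (suc a ∸ iR) false))
      ∧ᵇ boxplus a (ED _≟_) (suc a) (take a x ++ drop n x)             ∎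
    where
    open ≡-Reasoning
    uM : Unique M
    uM = subst Unique slice-core (ED-sound coreDistinct)

decompose : {A : Set} (n a : ℕ) (x : List A) → a ≤ n → length x ≡ n + suc a ∸ 1 →
  Σ (List A) λ L → Σ (List A) λ M → Σ (List A) λ R →
    (a ≡ length L) × (n ≡ length L + length M) × (x ≡ L ++ M ++ R)
decompose {A} n a x a≤n len = L , M , R , sym |L| , sym |L|+|M| , sym reassemble
  where
  L M R : List A
  L = take a x
  M = take (n ∸ a) (drop a x)
  R = drop n x
  |x| : length x ≡ n + a
  |x| = trans len (cong (_∸ 1) (+-suc n a))
  |L| : length L ≡ a
  |L| = trans (length-take a x) (m≤n⇒m⊓n≡m (subst (a ≤_) (sym |x|) (m≤n+m a n)))
  |drop-a| : length (drop a x) ≡ n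
  |drop-a| = trans (length-drop a x) (trans (cong (_∸ a) |x|) (m+n∸n≡m n a))
  |L|+|M| : length L + length M ≡ n
  |L|+|M| = trans (cong₂ _+_ |L| (trans (length-take (n ∸ a) (drop a x))
                                         (m≤n⇒m⊓n≡m (subst (n ∸ a ≤_) (sym |drop-a|) (m∸n≤m n a)))))
                  (m+[n∸m]≡n a≤n)
  rest : M ++ R ≡ drop a x
  rest = trans (cong (M ++_) (sym (trans (drop-drop a (n ∸ a) x) (cong (λ t → drop t x) (m+[n∸m]≡n a≤n)))))
               (take++drop≡id (n ∸ a) (drop a x))
  reassemble : L ++ M ++ R ≡ x
  reassemble = trans (cong (L ++_) rest) (take++drop≡id a x)

lemma5 : {A : Set} (_≟_ : DecidableEquality A) (n m : ℕ) → 0 < m → m < n →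
    (x : List A) → length x ≡ n + m ∸ 1 →
    (ED _≟_ (slice m n x) ≡ false →
       boxplus n (ED _≟_) m x ≡ replicate m false)
    × (ED _≟_ (slice m n x) ≡ true →
       boxplus n (ED _≟_) m x
         ≡ ((replicate (maxFalse (m ∸ 1) (λ j → ED _≟_ (slice j n x))) false
              ++ replicate (m ∸ maxFalse (m ∸ 1) (λ j → ED _≟_ (slice j n x))) true)
            ∧ᵇ (replicate (fromMaybe m (minFalse (m ∸ 1) (λ j → ED _≟_ (slice m (n + j) x)))) true
              ++ replicate (m ∸ fromMaybe m (minFalse (m ∸ 1) (λ j → ED _≟_ (slice m (n + j) x)))) false))
            ∧ᵇ boxplus (m ∸ 1) (ED _≟_) m (take (m ∸ 1) x ++ drop n x))
lemma5 _≟_ n (suc a) _ m<n x len with decompose n a x (≤-trans (n≤1+n a) (<⇒≤ m<n)) len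
... | L , M , R , refl , refl , refl = partA , partB
  where open Windows _≟_ L M R
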